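{- Let $x\in\mathcal S$ with $x\ne x^{\max}$. For each rotation $R\in\mathcal R(x)$, the g-matching $x':=x+\chi^R$ is stable and satisfies $x\prec_F x'$.
   Context: Model. $G=(V,E)$ is a finite bipartite graph without multiple edges with color classes $W$ and $F$; an edge joining $w\in W$, $f\in F$ is written $wf$. Capacities $b\in\mathbb Z_+^E$. For $v\in V$, $E_v$ is the set of edges at $v$, $\mathcal B_v=\{z\in\mathbb Z_+^{E_v}:z\le b|_{E_v}\}$, $\mathcal B=\{x\in\mathbb Z_+^E:x\le b\}$, $x_v$ the restriction of $x$ to $E_v$. Vector inequalities componentwise, $\wedge,\vee$ componentwise min/max, $|z|=\sum_e|z(e)|$, $\mathbf 1^e$ unit vector of $e$. Each $v$ has a choice function $C_v:\mathcal B_v\to\mathcal B_v$, $C_v(z)\le z$, with: (A1) $z\ge z'\ge C_v(z)\Rightarrow C_v(z')=C_v(z)$; (A2) $z\ge z'\Rightarrow C_v(z)\wedge z'\le C_v(z')$; (A3) $z\ge z'\Rightarrow|C_v(z)|\ge|C_v(z')|$. $z$ is acceptable if $C_v(z)=z$; for distinct acceptable $z,z'$, $z'\prec_v z$ iff $C_v(z\vee z')=z$ ($\preceq_v$ allows equality). $e\in E_v$ is interesting for $v$ under acceptable $z$ if some $z'\in\mathcal B_v$ agrees with $z$ off $e$, has $z'(e)>z(e)$ and $C_v(z')(e)>z(e)$. A g-matching is $x\in\mathcal B$ with all $x_v$ acceptable; $wf$ blocks $x$ if interesting for $w$ under $x_w$ and for $f$ under $x_f$; stable = no blocking edge; $\mathcal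 S$ = stable g-matchings; $x\prec_F y$ (distinct) iff $x_f\preceq_f y_f$ for all $f\in F$. $(\mathcal S,\prec_F)$ is a finite distributive lattice with greatest element $x^{\max}$. Rotations. For $x\in\mathcal S$: $U_F^+(x)$ = edges $wf$ interesting for $f$ under $x_f$; $U_F^-(x)$ = edges $wf$ with $x(wf)>0$ not interesting for $f$ under $x_f$. Legal $F$-pair at $f$: distinct $a,c\in E_f$, $a\in U_F^+(x)$, $C_f(x_f+\mathbf 1^a)=x_f+\mathbf 1^a-\mathbf 1^c$. Legal $W$-pair at $w$: $c,a\in E_w$, $c\in U_F^-(x)$, $a\in U_F^+(x)$, $x_w+\mathbf 1^a-\mathbf 1^c$ acceptable; essential if no $d\in(U_F^+(x)\cap E_w)\setminus\{a\}$ is interesting for $w$ under $x_w+\mathbf 1^a-\mathbf 1^c$. A rotation applicable to $x$ is a cyclic sequence $R=(a_1,c_1,\dots,a_k,c_k)$ of pairwise distinct edges with $(a_i,c_i)$ legal $F$-pairs and $(c_i,a_{i+1})$ essential $W$-pairs (indices mod $k$); $\chi^R\in\mathbb Z^E$ is $1$ on the $a_i$, $-1$ on the $c_i$, $0$ elsewhere; $\mathcal R(x)$ is the set of rotations applicable to $x$. -}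

module Defs where

open import Data.Nat using (ℕ; zero; suc; _≤_; _<_; _⊓_; _⊔_; pred)
import Data.Nat as ℕ
open import Data.Fin using (Fin; toℕ; fromℕ<; _≟_)
import Data.Fin.Properties as FinP
open import Data.Vec using (Vec; lookup; tabulate; zipWith; sum)
open import Data.Sum using (_⊎_; inj₁; inj₂)
open import Data.Product using (Σ; _×_; _,_; ∃; ∃-syntax)
open import Data.Bool using (Bool; true; false; if_then_else_)
open import Relation.Nullary using (¬_; does; yes; no)
open import Relation.Binary.PropositionalEquality using (_≡_; _≢_)

record Graph : Set where
  field
    nW nF m : ℕ
    wOf    : Fin m → Fin nW
    fOf    : Fin m → Fin nF
    simple : ∀ e e' → wOf e ≡ wOf e' → fOf e ≡ fOf e' → e ≡ e'
    cap    : Vec ℕ m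

module GraphDefs (G : Graph) where
  open Graph G public

  V : Set
  V = Fin nW ⊎ Fin nF

  Vecᴱ : Set
  Vecᴱ = Vec ℕ m

  incᵇ : V → Fin m → Bool
  incᵇ (inj₁ w) e = does (wOf e ≟ w)
  incᵇ (inj₂ f) e = does (fOf e ≟ f)

  _∈E_ : Fin m → V → Set
  e ∈E v = incᵇ v e ≡ true

  _≤ᵛ_ : Vecᴱ → Vecᴱ → Set
  z ≤ᵛ z' = ∀ e → lookup z e ≤ lookup z' e

  _∧_ : Vecᴱ → Vecᴱ → Vecᴱ
  _∧_ = zipWith _⊓_

  _∨_ : Vecᴱ → Vecᴱ → Vecᴱ
  _∨_ = zipWith _⊔_

  ∣_∣ : Vecᴱ → ℕ
  ∣ z ∣ = sum z

  -- z + 1^a   and   z - 1^c  (the latter only used where z(c) ≥ 1)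
  plus1 : Vecᴱ → Fin m → Vecᴱ
  plus1 z a = tabulate (λ e → if does (e ≟ a) then suc (lookup z e) else lookup z e)

  minus1 : Vecᴱ → Fin m → Vecᴱ
  minus1 z c = tabulate (λ e → if does (e ≟ c) then pred (lookup z e) else lookup z e)

  -- x_v : restriction of x to E_v, encoded as a vector on E vanishing off E_v
  restr : Vecᴱ → V → Vecᴱ
  restr x v = tabulate (λ e → if incᵇ v e then lookup x e else 0)

  -- 𝓑 and 𝓑_v  (ℤ₊^{E_v} encoded as vectors on E vanishing off E_v)
  In𝓑 : Vecᴱ → Set
  In𝓑 z = z ≤ᵛ cap

  In𝓑ᵥ : V → Vecᴱ → Set
  In𝓑ᵥ v z = z ≤ᵛ cap × (∀ e → ¬ (e ∈E v) → lookup z e ≡ 0)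

-- Choice functions C_v : 𝓑_v → 𝓑_v with C_v(z) ≤ z and axioms (A1)–(A3).
-- (Values of C_v outside 𝓑_v are irrelevant.)

record ChoiceModel (G : Graph) : Set where
  open GraphDefs G
  field
    C     : V → Vecᴱ → Vecᴱ
    C≤    : ∀ v z → In𝓑ᵥ v z → C v z ≤ᵛ z
    A1    : ∀ v z z' → In𝓑ᵥ v z → In𝓑ᵥ v z' →
            z' ≤ᵛ z → C v z ≤ᵛ z' → C v z' ≡ C v z
    A2    : ∀ v z z' → In𝓑ᵥ v z → In𝓑ᵥ v z' →
            z' ≤ᵛ z → (C v z ∧ z') ≤ᵛ C v z'
    A3    : ∀ v z z' → In𝓑ᵥ v z → In𝓑ᵥ v z' →
            z' ≤ᵛ z → ∣ C v z' ∣ ≤ ∣ C v z ∣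

next : ∀ {n} → Fin (suc n) → Fin (suc n)
next {n} i with toℕ i ℕ.<? n
... | yes p = fromℕ< (ℕ.s≤s p)
... | no _  = Fin.zero

module Model (G : Graph) (M : ChoiceModel G) where
  open GraphDefs G public
  open ChoiceModel M public

  Acceptable : V → Vecᴱ → Set
  Acceptable v z = C v z ≡ z

  _≺[_]_ : Vecᴱ → V → Vecᴱ → Set
  z' ≺[ v ] z = Acceptable v z' × Acceptable v z × z' ≢ z × C v (z ∨ z') ≡ z

  _⪯[_]_ : Vecᴱ → V → Vecᴱ → Set
  z' ⪯[ v ] z = z' ≡ z ⊎ z' ≺[ v ] z

  Interesting : V → Vecᴱ → Fin m → Set
  Interesting v z e =
    e ∈E v ×
    ∃[ z' ] (In𝓑ᵥ v z' ×
             (∀ e' → e' ≢ e → lookup z' e' ≡ lookup z e') ×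
             lookup z e < lookup z' e ×
             lookup z e < lookup (C v z') e)

  GMatching : Vecᴱ → Set
  GMatching x = In𝓑 x × (∀ v → Acceptable v (restr x v))

  Blocks : Vecᴱ → Fin m → Set
  Blocks x e = Interesting (inj₁ (wOf e)) (restr x (inj₁ (wOf e))) e
             × Interesting (inj₂ (fOf e)) (restr x (inj₂ (fOf e))) e

  Stable : Vecᴱ → Set
  Stable x = GMatching x × (∀ e → ¬ Blocks x e)

  _≺F_ : Vecᴱ → Vecᴱ → Set
  x ≺F y = x ≢ y × (∀ f → restr x (inj₂ f) ⪯[ inj₂ f ] restr y (inj₂ f))

  _⪯F_ : Vecᴱ → Vecᴱ → Set
  x ⪯F y = x ≡ y ⊎ x ≺F y

  IsMax : Vecᴱ → Set
  IsMax xm = Stable xm × (∀ y → Stable y → y ⪯F xm)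

  U⁺ : Vecᴱ → Fin m → Set
  U⁺ x e = Interesting (inj₂ (fOf e)) (restr x (inj₂ (fOf e))) e

  U⁻ : Vecᴱ → Fin m → Set
  U⁻ x e = 0 < lookup x e × ¬ Interesting (inj₂ (fOf e)) (restr x (inj₂ (fOf e))) e

  -- legal F-pair (a, c) at f:  C_f(x_f + 1^a) = x_f + 1^a - 1^c,
  -- written equivalently (over ℕ) as C_f(x_f + 1^a) + 1^c = x_f + 1^a
  LegalFPair : Vecᴱ → Fin nF → Fin m → Fin m → Set
  LegalFPair x f a c =
    a ≢ c × a ∈E inj₂ f × c ∈E inj₂ f × U⁺ x a ×
    plus1 (C (inj₂ f) (plus1 (restr x (inj₂ f)) a)) c ≡ plus1 (restr x (inj₂ f)) a

  -- legal W-pair (c, a) at w  (x_w + 1^a - 1^c is in ℤ₊ since c ∈ U_F^-(x))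
  wShift : Vecᴱ → Fin nW → Fin m → Fin m → Vecᴱ
  wShift x w c a = minus1 (plus1 (restr x (inj₁ w)) a) c

  LegalWPair : Vecᴱ → Fin nW → Fin m → Fin m → Set
  LegalWPair x w c a =
    c ∈E inj₁ w × a ∈E inj₁ w × U⁻ x c × U⁺ x a ×
    Acceptable (inj₁ w) (wShift x w c a)

  EssentialWPair : Vecᴱ → Fin nW → Fin m → Fin m → Set
  EssentialWPair x w c a =
    LegalWPair x w c a ×
    (∀ d → U⁺ x d → d ∈E inj₁ w → d ≢ a →
       ¬ Interesting (inj₁ w) (wShift x w c a) d)

  -- a rotation (a_1,c_1,…,a_k,c_k), k = suc n ≥ 1, indices mod k
  record Rotation (x : Vecᴱ) : Set where
    field
      n      : ℕ
      a c    : Fin (suc n) → Fin m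
      a-inj  : ∀ i j → a i ≡ a j → i ≡ j
      c-inj  : ∀ i j → c i ≡ c j → i ≡ j
      a≢c    : ∀ i j → a i ≢ c j
      fpair  : ∀ i → LegalFPair x (fOf (a i)) (a i) (c i)
      wpair  : ∀ i → EssentialWPair x (wOf (c i)) (c i) (a (next i))

  applyRot : (x : Vecᴱ) → Rotation x → Vecᴱ
  applyRot x R = tabulate λ e →
    if does (FinP.any? (λ i → a i ≟ e)) then suc (lookup x e)
    else if does (FinP.any? (λ i → c i ≟ e)) then pred (lookup x e)
    else lookup x e
    where open Rotation R

module Submission where

-- Since f(a_i) = f(c_i) and w(c_i) = w(a_{i+1}), every vertex gains exactly as many
-- units along R as it loses, so |x'_v| = |x_v|.  The workhorse is a consequence of (A1) and (A2): if z is
-- acceptable and Z ≥ z exceeds z only on edges that are not interesting for v under z, then C_v(Z) = z.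
--
-- By stability of x no edge of U_F^+(x) is interesting for w under x_w, and by essentiality of
-- the W-pair none other than a_{i+1} is interesting under x_w + 1^{a_{i+1}} − 1^{c_i}.  Via (A2) this gives
-- x'_w ≤ C_w(z') for every z' ≥ x'_w that exceeds x'_w only on U_F^+(x).  Taking z' = x'_w shows that x'_w
-- is acceptable; for an edge e ∈ U_F^+(x) interesting for w under x'_w, (A3) and |x'_w| = |x_w| bound
-- |C_w(z')| by |x'_w|, contradicting x'_w ≤ C_w(z') with strict inequality at e.
--
-- For f met by R the legal F-pairs and (A2) give C_f(x'_f ∨ x_f) ≤ x'_f, and (A3) gives equal
-- sizes, so C_f(x'_f ∨ x_f) = x'_f: x'_f is acceptable and x_f ≺_f x'_f.  Running the same argument on
-- (x'_f ∨ x_f) ∨ z' shows that no edge outside U_F^+(x) is interesting for f under x'_f.  Hence no edge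
-- blocks x'.

open import Defs
open import Data.Product using (_×_)
open import Relation.Binary.PropositionalEquality using (_≢_)

open import Data.Bool using (true; false; if_then_else_)
open import Data.Bool.Properties using () renaming (_≟_ to _≟ᵇ_)
open import Data.Empty using (⊥-elim)
open import Data.Fin using (Fin; zero; suc; toℕ; fromℕ; inject₁)
open import Data.Fin.Properties
  using (_≟_; any?; toℕ-injective; toℕ-fromℕ; toℕ-fromℕ<; toℕ-inject₁; toℕ<n)
open import Data.Nat using (ℕ; zero; suc; _+_; _≤_; _<_; _⊓_; _⊔_; pred; z≤n; s≤s; _<?_; >-nonZero)
open import Data.Nat.Properties hiding (_≟_)
open import Data.Product using (∃; _,_; proj₁; proj₂)
open import Data.Sum using (inj₁; inj₂)
open import Data.Vec using (Vec; []; _∷_; lookup; sum; _[_]≔_)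
open import Data.Vec.Properties
  using (lookup∘tabulate; tabulate∘lookup; tabulate-cong; lookup-zipWith; lookup∘update; lookup∘update′)
open import Function using (_∘_)
open import Relation.Binary.PropositionalEquality
open import Relation.Nullary using (¬_; Dec; does; yes; no)
open import Relation.Nullary.Decidable using (dec-true; dec-false)
import Algebra.Properties.CommutativeMonoid.Sum +-0-commutativeMonoid as ∑

if-dec-yes : ∀ {P A : Set} (d : Dec P) {p q : A} → P → (if does d then p else q) ≡ p
if-dec-yes d h rewrite dec-true d h = refl

if-dec-no : ∀ {P A : Set} (d : Dec P) {p q : A} → ¬ P → (if does d then p else q) ≡ q
if-dec-no d h rewrite dec-false d h = refl

does-true⇒ : ∀ {P : Set} (d : Dec P) → does d ≡ true → P
does-true⇒ (yes p) _ = p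

m⊓n≤o<n⇒m≤o : ∀ {p q t} → p ⊓ q ≤ t → t < q → p ≤ t
m⊓n≤o<n⇒m≤o {p} {q} p⊓q≤t t<q with ≤-total p q
... | inj₁ p≤q = subst (_≤ _) (m≤n⇒m⊓n≡m p≤q) p⊓q≤t
... | inj₂ q≤p = ⊥-elim (<⇒≱ t<q (subst (_≤ _) (m≥n⇒m⊓n≡n q≤p) p⊓q≤t))

lookup≗⇒≡ : ∀ {A : Set} {k} {u v : Vec A k} → (∀ e → lookup u e ≡ lookup v e) → u ≡ v
lookup≗⇒≡ {u = u} {v} u≗v =
  trans (sym (tabulate∘lookup u)) (trans (tabulate-cong u≗v) (tabulate∘lookup v))

sum-mono-≤ : ∀ {k} (u v : Vec ℕ k) → (∀ e → lookup u e ≤ lookup v e) → sum u ≤ sum v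
sum-mono-≤ []      []      _   = z≤n
sum-mono-≤ (_ ∷ u) (_ ∷ v) u≤v = +-mono-≤ (u≤v zero) (sum-mono-≤ u v (u≤v ∘ suc))

sum-mono-< : ∀ {k} (u v : Vec ℕ k) → (∀ e → lookup u e ≤ lookup v e) →
             ∀ e → lookup u e < lookup v e → sum u < sum v
sum-mono-< (_ ∷ u) (_ ∷ v) u≤v zero    u<v = +-mono-<-≤ u<v (sum-mono-≤ u v (u≤v ∘ suc))
sum-mono-< (_ ∷ u) (_ ∷ v) u≤v (suc e) u<v =
  +-mono-≤-< (u≤v zero) (sum-mono-< u v (u≤v ∘ suc) e u<v)

pointwise-≤∧sum-≥⇒≡ : ∀ {k} (u v : Vec ℕ k) → (∀ e → lookup u e ≤ lookup v e) →
                      sum v ≤ sum u → u ≡ v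
pointwise-≤∧sum-≥⇒≡ u v u≤v Σv≤Σu =
  lookup≗⇒≡ λ e → ≤-antisym (u≤v e) (≮⇒≥ λ u<v → <⇒≱ (sum-mono-< u v u≤v e u<v) Σv≤Σu)

sum≡∑lookup : ∀ {k} (v : Vec ℕ k) → sum v ≡ ∑.sum (lookup v)
sum≡∑lookup []      = refl
sum≡∑lookup (p ∷ v) = cong (p +_) (sum≡∑lookup v)

∑-δ : ∀ {k} (j : Fin k) (g : Fin k → ℕ) →
      ∑.sum (λ e → if does (j ≟ e) then g e else 0) ≡ g j
∑-δ {suc k} zero    g = trans (cong (g zero +_) (∑.sum-replicate-zero k)) (+-identityʳ _)
∑-δ {suc k} (suc j) g = ∑-δ j (g ∘ suc)

∑-fibres : ∀ {k l} (b : Fin k → Fin l) (g : Fin l → ℕ) →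
           ∑.sum (λ e → ∑.sum (λ i → if does (b i ≟ e) then g e else 0)) ≡ ∑.sum (g ∘ b)
∑-fibres b g = trans (∑.∑-comm (λ e i → if does (b i ≟ e) then g e else 0))
                     (∑.sum-cong-≗ λ i → ∑-δ (b i) g)

∑-fibre-∉ : ∀ {k l} (b : Fin k → Fin l) {e : Fin l} (K : ℕ) → (∀ i → b i ≢ e) →
            ∑.sum (λ i → if does (b i ≟ e) then K else 0) ≡ 0
∑-fibre-∉ {k} b K b≢e =
  trans (∑.sum-cong-≗ λ i → if-dec-no (b _ ≟ _) (b≢e i)) (∑.sum-replicate-zero k)

∑-fibre-injective : ∀ {k l} {b : Fin k → Fin l} → (∀ i j → b i ≡ b j → i ≡ j) →
                    ∀ j (K : ℕ) → ∑.sum (λ i → if does (b i ≟ b j) then K else 0) ≡ K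
∑-fibre-injective {b = b} b-inj j K = trans (∑.sum-cong-≗ fibre≗δ) (∑-δ j (λ _ → K))
  where
  fibre≗δ : ∀ i → (if does (b i ≟ b j) then K else 0) ≡ (if does (j ≟ i) then K else 0)
  fibre≗δ i with b i ≟ b j | j ≟ i
  ... | yes bi≡bj | no j≢i   = ⊥-elim (j≢i (b-inj j i (sym bi≡bj)))
  ... | no bi≢bj  | yes refl = ⊥-elim (bi≢bj refl)
  ... | yes _     | yes _    = refl
  ... | no _      | no _     = refl

next-inject₁ : ∀ {k} (i : Fin k) → next (inject₁ i) ≡ suc i
next-inject₁ {k} i with toℕ (inject₁ i) <? k
... | yes i<k = toℕ-injective (trans (toℕ-fromℕ< (s≤s i<k)) (cong suc (toℕ-inject₁ i)))
... | no i≮k  = ⊥-elim (i≮k (subst (_< k) (sym (toℕ-inject₁ i)) (toℕ<n i)))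

next-fromℕ : ∀ k → next (fromℕ k) ≡ zero
next-fromℕ k with toℕ (fromℕ k) <? k
... | yes k<k = ⊥-elim (n≮n k (subst (_< k) (toℕ-fromℕ k) k<k))
... | no _    = refl

next-surjective : ∀ {k} (j : Fin (suc k)) → ∃ λ i → next i ≡ j
next-surjective {k} zero = fromℕ k , next-fromℕ k
next-surjective (suc j)  = inject₁ j , next-inject₁ j

∑-next : ∀ {k} (g : Fin (suc k) → ℕ) → ∑.sum (g ∘ next) ≡ ∑.sum g
∑-next {k} g = begin
  ∑.sum (g ∘ next)                                ≡⟨ ∑.sum-init-last (g ∘ next) ⟩
  ∑.sum (g ∘ next ∘ inject₁) + g (next (fromℕ k)) ≡⟨ cong₂ _+_ (∑.sum-cong-≗ (cong g ∘ next-inject₁))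
                                                                (cong g (next-fromℕ k)) ⟩
  ∑.sum (g ∘ suc) + g zero                        ≡⟨ +-comm _ (g zero) ⟩
  ∑.sum g                                         ∎
  where open ≡-Reasoning

module ModelProperties (G : Graph) (M : ChoiceModel G) where
  open Model G M

  ∈E⇒wOf≡ : ∀ {e w} → e ∈E inj₁ w → wOf e ≡ w
  ∈E⇒wOf≡ {e} {w} = does-true⇒ (wOf e ≟ w)

  ∈E⇒fOf≡ : ∀ {e f} → e ∈E inj₂ f → fOf e ≡ f
  ∈E⇒fOf≡ {e} {f} = does-true⇒ (fOf e ≟ f)

  _∈E?_ : ∀ e v → Dec (e ∈E v)
  e ∈E? v = incᵇ v e ≟ᵇ true

  inc : V → Fin m → ℕ
  inc v e = if incᵇ v e then 1 else 0

  lookup-restr : ∀ y v e → lookup (restr y v) e ≡ (if incᵇ v e then lookup y e else 0)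
  lookup-restr y v e = lookup∘tabulate _ e

  lookup-restr-∈ : ∀ y v {e} → e ∈E v → lookup (restr y v) e ≡ lookup y e
  lookup-restr-∈ y v {e} e∈v = trans (lookup-restr y v e) (cong (if_then lookup y e else 0) e∈v)

  lookup-restr-∉ : ∀ y v {e} → ¬ e ∈E v → lookup (restr y v) e ≡ 0
  lookup-restr-∉ y v {e} e∉v with incᵇ v e in eq
  ... | true  = ⊥-elim (e∉v refl)
  ... | false = trans (lookup-restr y v e) (cong (if_then lookup y e else 0) eq)

  lookup-restr-mono : ∀ y z v e → lookup y e ≤ lookup z e → lookup (restr y v) e ≤ lookup (restr z v) e
  lookup-restr-mono y z v e y≤z rewrite lookup-restr y v e | lookup-restr z v e with incᵇ v e
  ... | true  = y≤z
  ... | false = z≤n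

  lookup-restr-suc : ∀ y z v e → lookup y e ≡ suc (lookup z e) →
                     lookup (restr y v) e ≡ lookup (restr z v) e + inc v e
  lookup-restr-suc y z v e y≡1+z rewrite lookup-restr y v e | lookup-restr z v e with incᵇ v e
  ... | true  = trans y≡1+z (+-comm 1 _)
  ... | false = refl

  lookup-plus1-≡ : ∀ z d → lookup (plus1 z d) d ≡ suc (lookup z d)
  lookup-plus1-≡ z d = trans (lookup∘tabulate _ d) (if-dec-yes (d ≟ d) refl)

  lookup-plus1-≢ : ∀ z {d e} → e ≢ d → lookup (plus1 z d) e ≡ lookup z e
  lookup-plus1-≢ z {d} {e} e≢d = trans (lookup∘tabulate _ e) (if-dec-no (e ≟ d) e≢d)

  lookup-minus1-≡ : ∀ z d → lookup (minus1 z d) d ≡ pred (lookup z d)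
  lookup-minus1-≡ z d = trans (lookup∘tabulate _ d) (if-dec-yes (d ≟ d) refl)

  lookup-minus1-≢ : ∀ z {d e} → e ≢ d → lookup (minus1 z d) e ≡ lookup z e
  lookup-minus1-≢ z {d} {e} e≢d = trans (lookup∘tabulate _ e) (if-dec-no (e ≟ d) e≢d)

  ∣plus1∣ : ∀ z d → ∣ plus1 z d ∣ ≡ suc ∣ z ∣
  ∣plus1∣ z d = begin
    sum (plus1 z d)                               ≡⟨ sum≡∑lookup (plus1 z d) ⟩
    ∑.sum (lookup (plus1 z d))                    ≡⟨ ∑.sum-cong-≗ lookup-plus1 ⟩
    ∑.sum (λ e → lookup z e + δ e)                ≡⟨ ∑.∑-distrib-+ (lookup z) δ ⟩
    ∑.sum (lookup z) + ∑.sum δ                    ≡⟨ cong₂ _+_ (sym (sum≡∑lookup z)) (∑-δ d (λ _ → 1)) ⟩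
    sum z + 1                                     ≡⟨ +-comm (sum z) 1 ⟩
    suc (sum z)                                   ∎
    where
    open ≡-Reasoning
    δ : Fin m → ℕ
    δ e = if does (d ≟ e) then 1 else 0
    lookup-plus1 : ∀ e → lookup (plus1 z d) e ≡ lookup z e + δ e
    lookup-plus1 e with e ≟ d
    ... | yes refl = trans (lookup-plus1-≡ z e)
                       (trans (+-comm 1 _) (cong (lookup z e +_) (sym (if-dec-yes (e ≟ e) refl))))
    ... | no e≢d   = trans (lookup-plus1-≢ z e≢d)
                       (sym (trans (cong (lookup z e +_) (if-dec-no (d ≟ e) (e≢d ∘ sym))) (+-identityʳ _)))

  lookup-∨ : ∀ u w e → lookup (u ∨ w) e ≡ lookup u e ⊔ lookup w e
  lookup-∨ u w e = lookup-zipWith _⊔_ e u w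

  lookup-∧ : ∀ u w e → lookup (u ∧ w) e ≡ lookup u e ⊓ lookup w e
  lookup-∧ u w e = lookup-zipWith _⊓_ e u w

  ≤ᵛ-∨ˡ : ∀ u w → u ≤ᵛ (u ∨ w)
  ≤ᵛ-∨ˡ u w e = subst (lookup u e ≤_) (sym (lookup-∨ u w e)) (m≤m⊔n _ _)

  ≤ᵛ-∨ʳ : ∀ u w → w ≤ᵛ (u ∨ w)
  ≤ᵛ-∨ʳ u w e = subst (lookup w e ≤_) (sym (lookup-∨ u w e)) (m≤n⊔m _ _)

  ∨-least : ∀ u w e {t} → lookup u e ≤ t → lookup w e ≤ t → lookup (u ∨ w) e ≤ t
  ∨-least u w e u≤t w≤t = subst (_≤ _) (sym (lookup-∨ u w e)) (⊔-lub u≤t w≤t)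

  <-∨⇒< : ∀ u w e → lookup u e < lookup (u ∨ w) e → lookup u e < lookup w e
  <-∨⇒< u w e u<u∨w = ≰⇒> λ w≤u → <⇒≱ u<u∨w (∨-least u w e ≤-refl w≤u)

  update-≤ᵛ : ∀ z Z d {t} → z ≤ᵛ Z → t ≤ lookup Z d → (z [ d ]≔ t) ≤ᵛ Z
  update-≤ᵛ z Z d {t} z≤Z t≤Zd e with e ≟ d
  ... | yes refl = subst (_≤ lookup Z d) (sym (lookup∘update d z t)) t≤Zd
  ... | no e≢d   = subst (_≤ lookup Z e) (sym (lookup∘update′ e≢d z t)) (z≤Z e)

  ≤ᵛ-update : ∀ z d {t} → lookup z d ≤ t → z ≤ᵛ (z [ d ]≔ t)
  ≤ᵛ-update z d {t} zd≤t e with e ≟ d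
  ... | yes refl = subst (lookup z d ≤_) (sym (lookup∘update d z t)) zd≤t
  ... | no e≢d   = ≤-reflexive (sym (lookup∘update′ e≢d z t))

  agree-off⇒≤ᵛ : ∀ (z z' : Vecᴱ) {e} → (∀ d → d ≢ e → lookup z' d ≡ lookup z d) →
                 lookup z e < lookup z' e → z ≤ᵛ z'
  agree-off⇒≤ᵛ z z' {e} agree z<z' d with d ≟ e
  ... | yes refl = <⇒≤ z<z'
  ... | no d≢e   = ≤-reflexive (sym (agree d d≢e))

  agree-off⇒exceeds-only-at : ∀ (z z' : Vecᴱ) {e} → (∀ d → d ≢ e → lookup z' d ≡ lookup z d) →
                              ∀ d → lookup z d < lookup z' d → d ≡ e
  agree-off⇒exceeds-only-at z z' {e} agree d z<z' with d ≟ e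
  ... | yes d≡e = d≡e
  ... | no d≢e  = ⊥-elim (<-irrefl (sym (agree d d≢e)) z<z')

  restr-∈𝓑ᵥ : ∀ y v → In𝓑 y → In𝓑ᵥ v (restr y v)
  restr-∈𝓑ᵥ y v y≤b = restr≤b , λ e → lookup-restr-∉ y v
    where
    restr≤b : ∀ e → lookup (restr y v) e ≤ lookup cap e
    restr≤b e rewrite lookup-restr y v e with incᵇ v e
    ... | true  = y≤b e
    ... | false = z≤n

  ∨-∈𝓑ᵥ : ∀ v u w → In𝓑ᵥ v u → In𝓑ᵥ v w → In𝓑ᵥ v (u ∨ w)
  ∨-∈𝓑ᵥ v u w (u≤b , u-off) (w≤b , w-off) =
    (λ e → ∨-least u w e (u≤b e) (w≤b e)) ,
    (λ e e∉v → trans (lookup-∨ u w e) (cong₂ _⊔_ (u-off e e∉v) (w-off e e∉v)))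

  ≤ᵛ-∈𝓑ᵥ : ∀ v z Z → z ≤ᵛ Z → In𝓑ᵥ v Z → In𝓑ᵥ v z
  ≤ᵛ-∈𝓑ᵥ v z Z z≤Z (Z≤b , Z-off) =
    (λ e → ≤-trans (z≤Z e) (Z≤b e)) ,
    (λ e e∉v → n≤0⇒n≡0 (subst (lookup z e ≤_) (Z-off e e∉v) (z≤Z e)))

  positive⇒∈E : ∀ v Z d → In𝓑ᵥ v Z → 0 < lookup Z d → d ∈E v
  positive⇒∈E v Z d (_ , Z-off) 0<Zd with d ∈E? v
  ... | yes d∈v = d∈v
  ... | no d∉v  = ⊥-elim (<⇒≢ 0<Zd (sym (Z-off d d∉v)))

  interesting⇒<cap : ∀ v z {e} → Interesting v z e → lookup z e < lookup cap e
  interesting⇒<cap v z {e} (_ , _ , (z'≤b , _) , _ , z<z' , _) = <-≤-trans z<z' (z'≤b e)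

  A2-lower : ∀ v Z z → In𝓑ᵥ v Z → In𝓑ᵥ v z → z ≤ᵛ Z → ∀ d {t} →
             t ≤ lookup (C v Z) d → t ≤ lookup z d → t ≤ lookup (C v z) d
  A2-lower v Z z Z∈𝓑 z∈𝓑 z≤Z d t≤CZ t≤z =
    ≤-trans (subst (_ ≤_) (sym (lookup-∧ (C v Z) z d)) (⊓-glb t≤CZ t≤z)) (A2 v Z z Z∈𝓑 z∈𝓑 z≤Z d)

  A2-upper : ∀ v Z z → In𝓑ᵥ v Z → In𝓑ᵥ v z → z ≤ᵛ Z → ∀ d {t} →
             lookup (C v z) d ≤ t → t < lookup z d → lookup (C v Z) d ≤ t
  A2-upper v Z z Z∈𝓑 z∈𝓑 z≤Z d Cz≤t =
    m⊓n≤o<n⇒m≤o (≤-trans (subst (_≤ _) (lookup-∧ (C v Z) z d) (A2 v Z z Z∈𝓑 z∈𝓑 z≤Z d)) Cz≤t)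

  A2-∨ʳ : ∀ v u z' → In𝓑ᵥ v u → In𝓑ᵥ v z' → ∀ d {t} →
          t ≤ lookup (C v (u ∨ z')) d → t ≤ lookup z' d → t ≤ lookup (C v z') d
  A2-∨ʳ v u z' u∈𝓑 z'∈𝓑 = A2-lower v (u ∨ z') z' (∨-∈𝓑ᵥ v u z' u∈𝓑 z'∈𝓑) z'∈𝓑 (≤ᵛ-∨ʳ u z')

  A3-∨ʳ : ∀ v u z' → In𝓑ᵥ v u → In𝓑ᵥ v z' → ∣ C v z' ∣ ≤ ∣ C v (u ∨ z') ∣
  A3-∨ʳ v u z' u∈𝓑 z'∈𝓑 = A3 v (u ∨ z') z' (∨-∈𝓑ᵥ v u z' u∈𝓑 z'∈𝓑) z'∈𝓑 (≤ᵛ-∨ʳ u z')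

  C-of-uninteresting-extension : ∀ v z Z → In𝓑ᵥ v z → Acceptable v z → In𝓑ᵥ v Z → z ≤ᵛ Z →
                                 (∀ d → lookup z d < lookup Z d → ¬ Interesting v z d) → C v Z ≡ z
  C-of-uninteresting-extension v z Z z∈𝓑 z-acceptable Z∈𝓑 z≤Z uninteresting =
    trans (sym (A1 v Z z Z∈𝓑 z∈𝓑 z≤Z CZ≤z)) z-acceptable
    where
    CZ≤z : C v Z ≤ᵛ z
    CZ≤z d with lookup z d <? lookup Z d
    ... | no z≮Z  = ≤-trans (C≤ v Z Z∈𝓑 d) (≮⇒≥ z≮Z)
    ... | yes z<Z = A2-upper v Z zᵈ Z∈𝓑 zᵈ∈𝓑 zᵈ≤Z d Czᵈ≤z z<zᵈ
      where
      zᵈ : Vecᴱ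
      zᵈ = z [ d ]≔ lookup Z d
      zᵈ≤Z : zᵈ ≤ᵛ Z
      zᵈ≤Z = update-≤ᵛ z Z d z≤Z ≤-refl
      zᵈ∈𝓑 : In𝓑ᵥ v zᵈ
      zᵈ∈𝓑 = ≤ᵛ-∈𝓑ᵥ v zᵈ Z zᵈ≤Z Z∈𝓑
      z<zᵈ : lookup z d < lookup zᵈ d
      z<zᵈ = subst (lookup z d <_) (sym (lookup∘update d z _)) z<Z
      -- zᵈ would witness that d is interesting if C v zᵈ exceeded z at d
      Czᵈ≤z : lookup (C v zᵈ) d ≤ lookup z d
      Czᵈ≤z = ≮⇒≥ λ z<Czᵈ → uninteresting d z<Z
        (positive⇒∈E v Z d Z∈𝓑 (≤-<-trans z≤n z<Z) , zᵈ , zᵈ∈𝓑 ,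
         (λ e e≢d → lookup∘update′ e≢d z _) , z<zᵈ , z<Czᵈ)

  C-∨-uninteresting : ∀ v z z' → In𝓑ᵥ v z → Acceptable v z → In𝓑ᵥ v z' →
                      (∀ d → lookup z d < lookup z' d → ¬ Interesting v z d) → C v (z ∨ z') ≡ z
  C-∨-uninteresting v z z' z∈𝓑 z-acceptable z'∈𝓑 uninteresting =
    C-of-uninteresting-extension v z (z ∨ z') z∈𝓑 z-acceptable (∨-∈𝓑ᵥ v z z' z∈𝓑 z'∈𝓑) (≤ᵛ-∨ˡ z z')
      (λ d z<z∨z' → uninteresting d (<-∨⇒< z z' d z<z∨z'))

module RotationStep (G : Graph) (M : ChoiceModel G) {x : Model.Vecᴱ G M}
                    (x-stable : Model.Stable G M x) (R : Model.Rotation G M x) where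
  open Model G M
  open ModelProperties G M
  open Rotation R

  x' : Vecᴱ
  x' = applyRot x R

  wᶜ : Fin (suc n) → Fin nW
  wᶜ l = wOf (c l)

  fᵃ : Fin (suc n) → Fin nF
  fᵃ j = fOf (a j)

  x∈𝓑 : In𝓑 x
  x∈𝓑 = proj₁ (proj₁ x-stable)

  x-acceptable : ∀ v → Acceptable v (restr x v)
  x-acceptable = proj₂ (proj₁ x-stable)

  a∈U⁺ : ∀ i → U⁺ x (a i)
  a∈U⁺ i = let (_ , _ , _ , aᵢ∈U⁺ , _) = fpair i in aᵢ∈U⁺

  a∈Eᶠ : ∀ i → a i ∈E inj₂ (fᵃ i)
  a∈Eᶠ i = let (_ , aᵢ∈E , _) = fpair i in aᵢ∈E

  c∈Eᶠ : ∀ i → c i ∈E inj₂ (fᵃ i)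
  c∈Eᶠ i = let (_ , _ , cᵢ∈E , _) = fpair i in cᵢ∈E

  fOf-c : ∀ i → fOf (c i) ≡ fᵃ i
  fOf-c i = ∈E⇒fOf≡ (c∈Eᶠ i)

  c∈Eʷ : ∀ i → c i ∈E inj₁ (wᶜ i)
  c∈Eʷ i = let ((cᵢ∈E , _) , _) = wpair i in cᵢ∈E

  next-a∈Eʷ : ∀ i → a (next i) ∈E inj₁ (wᶜ i)
  next-a∈Eʷ i = let ((_ , aᵢ₊₁∈E , _) , _) = wpair i in aᵢ₊₁∈E

  wOf-next-a : ∀ i → wOf (a (next i)) ≡ wᶜ i
  wOf-next-a i = ∈E⇒wOf≡ (next-a∈Eʷ i)

  x-c-positive : ∀ i → 0 < lookup x (c i)
  x-c-positive i = let ((_ , _ , (0<xcᵢ , _) , _) , _) = wpair i in 0<xcᵢ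

  data Role (e : Fin m) : Set where
    rotated-a : ∀ j → a j ≡ e → Role e
    rotated-c : ∀ j → c j ≡ e → Role e
    fixed     : (∀ j → a j ≢ e) → (∀ j → c j ≢ e) → Role e

  role : ∀ e → Role e
  role e with any? (λ i → a i ≟ e)
  ... | yes (j , aⱼ≡e) = rotated-a j aⱼ≡e
  ... | no e∉a with any? (λ i → c i ≟ e)
  ...   | yes (j , cⱼ≡e) = rotated-c j cⱼ≡e
  ...   | no e∉c = fixed (λ j aⱼ≡e → e∉a (j , aⱼ≡e)) (λ j cⱼ≡e → e∉c (j , cⱼ≡e))

  x'-a : ∀ j → lookup x' (a j) ≡ suc (lookup x (a j))
  x'-a j = trans (lookup∘tabulate _ (a j)) (if-dec-yes (any? (λ i → a i ≟ a j)) (j , refl))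

  x'-c : ∀ j → lookup x' (c j) ≡ pred (lookup x (c j))
  x'-c j = trans (lookup∘tabulate _ (c j))
    (trans (if-dec-no (any? (λ i → a i ≟ c j)) (λ (i , aᵢ≡cⱼ) → a≢c i j aᵢ≡cⱼ))
           (if-dec-yes (any? (λ i → c i ≟ c j)) (j , refl)))

  x'-fixed : ∀ {e} → (∀ j → a j ≢ e) → (∀ j → c j ≢ e) → lookup x' e ≡ lookup x e
  x'-fixed {e} e∉a e∉c = trans (lookup∘tabulate _ e)
    (trans (if-dec-no (any? (λ i → a i ≟ e)) (λ (i , aᵢ≡e) → e∉a i aᵢ≡e))
           (if-dec-no (any? (λ i → c i ≟ e)) (λ (i , cᵢ≡e) → e∉c i cᵢ≡e)))

  x'-c+1 : ∀ j → suc (lookup x' (c j)) ≡ lookup x (c j)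
  x'-c+1 j = trans (cong suc (x'-c j)) (suc-pred _ {{>-nonZero (x-c-positive j)}})

  x'≤x-off-a : ∀ e → (∀ j → a j ≢ e) → lookup x' e ≤ lookup x e
  x'≤x-off-a e e∉a with role e
  ... | rotated-a j aⱼ≡e = ⊥-elim (e∉a j aⱼ≡e)
  ... | rotated-c j refl = ≤-trans (≤-reflexive (x'-c j)) pred[n]≤n
  ... | fixed _ e∉c      = ≤-reflexive (x'-fixed e∉a e∉c)

  x≤x'-off-c : ∀ e → (∀ j → c j ≢ e) → lookup x e ≤ lookup x' e
  x≤x'-off-c e e∉c with role e
  ... | rotated-a j refl = ≤-trans (n≤1+n _) (≤-reflexive (sym (x'-a j)))
  ... | rotated-c j cⱼ≡e = ⊥-elim (e∉c j cⱼ≡e)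
  ... | fixed e∉a _      = ≤-reflexive (sym (x'-fixed e∉a e∉c))

  x-a<cap : ∀ j → lookup x (a j) < lookup cap (a j)
  x-a<cap j = subst (_< lookup cap (a j)) (lookup-restr-∈ x (inj₂ (fᵃ j)) (a∈Eᶠ j))
                    (interesting⇒<cap (inj₂ (fᵃ j)) (restr x (inj₂ (fᵃ j))) (a∈U⁺ j))

  x'∈𝓑 : In𝓑 x'
  x'∈𝓑 e with role e
  ... | rotated-a j refl = subst (_≤ lookup cap e) (sym (x'-a j)) (x-a<cap j)
  ... | rotated-c j refl = ≤-trans (x'≤x-off-a e (λ i → a≢c i j)) (x∈𝓑 e)
  ... | fixed e∉a _      = ≤-trans (x'≤x-off-a e e∉a) (x∈𝓑 e)

  multiplicity : (Fin (suc n) → Fin m) → V → Fin m → ℕ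
  multiplicity b v e = ∑.sum (λ i → if does (b i ≟ e) then inc v e else 0)

  x'+mult-c≡x+mult-a : ∀ v e → lookup (restr x' v) e + multiplicity c v e
                              ≡ lookup (restr x v) e + multiplicity a v e
  x'+mult-c≡x+mult-a v e with role e
  ... | rotated-a j refl = begin
    x'ᵥ + multiplicity c v e ≡⟨ cong (x'ᵥ +_) (∑-fibre-∉ c (inc v e) (λ i cᵢ≡aⱼ → a≢c j i (sym cᵢ≡aⱼ))) ⟩
    x'ᵥ + 0                  ≡⟨ +-identityʳ x'ᵥ ⟩
    x'ᵥ                      ≡⟨ lookup-restr-suc x' x v e (x'-a j) ⟩
    xᵥ + inc v e             ≡⟨ cong (xᵥ +_) (∑-fibre-injective a-inj j (inc v e)) ⟨
    xᵥ + multiplicity a v e  ∎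
    where
    open ≡-Reasoning
    x'ᵥ = lookup (restr x' v) e
    xᵥ  = lookup (restr x v) e
  ... | rotated-c j refl = begin
    x'ᵥ + multiplicity c v e ≡⟨ cong (x'ᵥ +_) (∑-fibre-injective c-inj j (inc v e)) ⟩
    x'ᵥ + inc v e            ≡⟨ lookup-restr-suc x x' v e (sym (x'-c+1 j)) ⟨
    xᵥ                       ≡⟨ +-identityʳ xᵥ ⟨
    xᵥ + 0                   ≡⟨ cong (xᵥ +_) (∑-fibre-∉ a (inc v e) (λ i aᵢ≡cⱼ → a≢c i j aᵢ≡cⱼ)) ⟨
    xᵥ + multiplicity a v e  ∎
    where
    open ≡-Reasoning
    x'ᵥ = lookup (restr x' v) e
    xᵥ  = lookup (restr x v) e
  ... | fixed e∉a e∉c = cong₂ _+_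
    (trans (lookup-restr x' v e)
           (trans (cong (if incᵇ v e then_else 0) (x'-fixed e∉a e∉c)) (sym (lookup-restr x v e))))
    (trans (∑-fibre-∉ c (inc v e) e∉c) (sym (∑-fibre-∉ a (inc v e) e∉a)))

  ∑-inc-c≡∑-inc-a : ∀ v → ∑.sum (inc v ∘ c) ≡ ∑.sum (inc v ∘ a)
  ∑-inc-c≡∑-inc-a (inj₂ f) = ∑.sum-cong-≗ λ i → cong (λ g → if does (g ≟ f) then 1 else 0) (fOf-c i)
  ∑-inc-c≡∑-inc-a (inj₁ w) = trans
    (∑.sum-cong-≗ λ i → cong (λ g → if does (g ≟ w) then 1 else 0) (sym (wOf-next-a i)))
    (∑-next (inc (inj₁ w) ∘ a))

  ∣x'ᵥ∣≡∣xᵥ∣ : ∀ v → ∣ restr x' v ∣ ≡ ∣ restr x v ∣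
  ∣x'ᵥ∣≡∣xᵥ∣ v = +-cancelʳ-≡ (∑.sum (inc v ∘ a)) _ _ (begin
    ∣ x'ᵥ ∣ + ∑.sum (inc v ∘ a)                      ≡⟨ cong (∣ x'ᵥ ∣ +_) (∑-inc-c≡∑-inc-a v) ⟨
    ∣ x'ᵥ ∣ + ∑.sum (inc v ∘ c)                      ≡⟨ cong₂ _+_ (sym (sum≡∑lookup x'ᵥ)) (∑-fibres c (inc v)) ⟨
    ∑.sum (lookup x'ᵥ) + ∑.sum (multiplicity c v)    ≡⟨ ∑.∑-distrib-+ (lookup x'ᵥ) (multiplicity c v) ⟨
    ∑.sum (λ e → lookup x'ᵥ e + multiplicity c v e)  ≡⟨ ∑.sum-cong-≗ (x'+mult-c≡x+mult-a v) ⟩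
    ∑.sum (λ e → lookup xᵥ e + multiplicity a v e)   ≡⟨ ∑.∑-distrib-+ (lookup xᵥ) (multiplicity a v) ⟩
    ∑.sum (lookup xᵥ) + ∑.sum (multiplicity a v)     ≡⟨ cong₂ _+_ (sym (sum≡∑lookup xᵥ)) (∑-fibres a (inc v)) ⟩
    ∣ xᵥ ∣ + ∑.sum (inc v ∘ a)                       ∎)
    where
    open ≡-Reasoning
    x'ᵥ = restr x' v
    xᵥ  = restr x v

  -- Workers

  xʷ x'ʷ : Fin nW → Vecᴱ
  xʷ  w = restr x  (inj₁ w)
  x'ʷ w = restr x' (inj₁ w)

  xʷ∈𝓑 : ∀ w → In𝓑ᵥ (inj₁ w) (xʷ w)
  xʷ∈𝓑 w = restr-∈𝓑ᵥ x (inj₁ w) x∈𝓑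

  x'ʷ∈𝓑 : ∀ w → In𝓑ᵥ (inj₁ w) (x'ʷ w)
  x'ʷ∈𝓑 w = restr-∈𝓑ᵥ x' (inj₁ w) x'∈𝓑

  x'ʷ≤xʷ-off-a : ∀ w e → (∀ j → a j ≢ e) → lookup (x'ʷ w) e ≤ lookup (xʷ w) e
  x'ʷ≤xʷ-off-a w e e∉a = lookup-restr-mono x' x (inj₁ w) e (x'≤x-off-a e e∉a)

  U⁺⇒¬interestingʷ : ∀ w d → U⁺ x d → ¬ Interesting (inj₁ w) (xʷ w) d
  U⁺⇒¬interestingʷ w d d∈U⁺ d-interesting with ∈E⇒wOf≡ (proj₁ d-interesting)
  ... | refl = proj₂ x-stable d (d-interesting , d∈U⁺)

  ExceedsOnlyOnU⁺ : Fin nW → Vecᴱ → Set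
  ExceedsOnlyOnU⁺ w z' = ∀ d → lookup (x'ʷ w) d < lookup z' d → U⁺ x d

  exceeds⇒U⁺ : ∀ w z z' → (∀ e → (∀ j → a j ≢ e) → lookup (x'ʷ w) e ≤ lookup z e) →
               ExceedsOnlyOnU⁺ w z' → ∀ d → lookup z d < lookup z' d → U⁺ x d
  exceeds⇒U⁺ w z z' x'ʷ≤z exceeds d z<z' with role d
  ... | rotated-a j refl = a∈U⁺ j
  ... | rotated-c j refl = exceeds d (≤-<-trans (x'ʷ≤z d (λ i → a≢c i j)) z<z')
  ... | fixed d∉a _      = exceeds d (≤-<-trans (x'ʷ≤z d d∉a) z<z')

  C-xʷ∨ : ∀ w z' → In𝓑ᵥ (inj₁ w) z' → ExceedsOnlyOnU⁺ w z' → C (inj₁ w) (xʷ w ∨ z') ≡ xʷ w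
  C-xʷ∨ w z' z'∈𝓑 exceeds =
    C-∨-uninteresting (inj₁ w) (xʷ w) z' (xʷ∈𝓑 w) (x-acceptable (inj₁ w)) z'∈𝓑
      (λ d x<z' → U⁺⇒¬interestingʷ w d (exceeds⇒U⁺ w (xʷ w) z' (x'ʷ≤xʷ-off-a w) exceeds d x<z'))

  x'ʷ≤C-off-a : ∀ w z' → In𝓑ᵥ (inj₁ w) z' → x'ʷ w ≤ᵛ z' → ExceedsOnlyOnU⁺ w z' →
                ∀ d → (∀ j → a j ≢ d) → lookup (x'ʷ w) d ≤ lookup (C (inj₁ w) z') d
  x'ʷ≤C-off-a w z' z'∈𝓑 x'≤z' exceeds d d∉a = A2-∨ʳ (inj₁ w) (xʷ w) z' (xʷ∈𝓑 w) z'∈𝓑 d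
    (subst (λ u → lookup (x'ʷ w) d ≤ lookup u d) (sym (C-xʷ∨ w z' z'∈𝓑 exceeds)) (x'ʷ≤xʷ-off-a w d d∉a))
    (x'≤z' d)

  exchangeʷ : Fin (suc n) → Vecᴱ
  exchangeʷ l = wShift x (wᶜ l) (c l) (a (next l))

  exchangeʷ-next-a : ∀ l → lookup (exchangeʷ l) (a (next l)) ≡ lookup (x'ʷ (wᶜ l)) (a (next l))
  exchangeʷ-next-a l = begin
    lookup (exchangeʷ l) a'           ≡⟨ lookup-minus1-≢ (plus1 (xʷ (wᶜ l)) a') (a≢c (next l) l) ⟩
    lookup (plus1 (xʷ (wᶜ l)) a') a'  ≡⟨ lookup-plus1-≡ (xʷ (wᶜ l)) a' ⟩
    suc (lookup (xʷ (wᶜ l)) a')       ≡⟨ cong suc (lookup-restr-∈ x (inj₁ (wᶜ l)) (next-a∈Eʷ l)) ⟩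
    suc (lookup x a')                 ≡⟨ x'-a (next l) ⟨
    lookup x' a'                      ≡⟨ lookup-restr-∈ x' (inj₁ (wᶜ l)) (next-a∈Eʷ l) ⟨
    lookup (x'ʷ (wᶜ l)) a'            ∎
    where
    open ≡-Reasoning
    a' = a (next l)

  exchangeʷ-c : ∀ l → lookup (exchangeʷ l) (c l) ≡ lookup (x'ʷ (wᶜ l)) (c l)
  exchangeʷ-c l = begin
    lookup (exchangeʷ l) (c l)                   ≡⟨ lookup-minus1-≡ (plus1 (xʷ (wᶜ l)) a') (c l) ⟩
    pred (lookup (plus1 (xʷ (wᶜ l)) a') (c l))   ≡⟨ cong pred (lookup-plus1-≢ (xʷ (wᶜ l)) c≢a') ⟩
    pred (lookup (xʷ (wᶜ l)) (c l))              ≡⟨ cong pred (lookup-restr-∈ x (inj₁ (wᶜ l)) (c∈Eʷ l)) ⟩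
    pred (lookup x (c l))                        ≡⟨ x'-c l ⟨
    lookup x' (c l)                              ≡⟨ lookup-restr-∈ x' (inj₁ (wᶜ l)) (c∈Eʷ l) ⟨
    lookup (x'ʷ (wᶜ l)) (c l)                    ∎
    where
    open ≡-Reasoning
    a' = a (next l)
    c≢a' : c l ≢ a'
    c≢a' c≡a' = a≢c (next l) l (sym c≡a')

  exchangeʷ-other : ∀ l {e} → e ≢ a (next l) → e ≢ c l → lookup (exchangeʷ l) e ≡ lookup (xʷ (wᶜ l)) e
  exchangeʷ-other l e≢a' e≢c =
    trans (lookup-minus1-≢ (plus1 (xʷ (wᶜ l)) (a (next l))) e≢c) (lookup-plus1-≢ (xʷ (wᶜ l)) e≢a')

  exchangeʷ≤x'ʷ∨xʷ : ∀ l → exchangeʷ l ≤ᵛ (x'ʷ (wᶜ l) ∨ xʷ (wᶜ l))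
  exchangeʷ≤x'ʷ∨xʷ l e with e ≟ a (next l) | e ≟ c l
  ... | yes refl | _        = ≤-trans (≤-reflexive (exchangeʷ-next-a l)) (≤ᵛ-∨ˡ (x'ʷ (wᶜ l)) (xʷ (wᶜ l)) e)
  ... | no _     | yes refl = ≤-trans (≤-reflexive (exchangeʷ-c l)) (≤ᵛ-∨ˡ (x'ʷ (wᶜ l)) (xʷ (wᶜ l)) e)
  ... | no e≢a'  | no e≢c   =
    ≤-trans (≤-reflexive (exchangeʷ-other l e≢a' e≢c)) (≤ᵛ-∨ʳ (x'ʷ (wᶜ l)) (xʷ (wᶜ l)) e)

  exchangeʷ∈𝓑 : ∀ l → In𝓑ᵥ (inj₁ (wᶜ l)) (exchangeʷ l)
  exchangeʷ∈𝓑 l = ≤ᵛ-∈𝓑ᵥ (inj₁ (wᶜ l)) (exchangeʷ l) (x'ʷ (wᶜ l) ∨ xʷ (wᶜ l)) (exchangeʷ≤x'ʷ∨xʷ l)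
    (∨-∈𝓑ᵥ (inj₁ (wᶜ l)) (x'ʷ (wᶜ l)) (xʷ (wᶜ l)) (x'ʷ∈𝓑 (wᶜ l)) (xʷ∈𝓑 (wᶜ l)))

  x'ʷ≤exchangeʷ-off-a : ∀ l e → (∀ j → a j ≢ e) → lookup (x'ʷ (wᶜ l)) e ≤ lookup (exchangeʷ l) e
  x'ʷ≤exchangeʷ-off-a l e e∉a with e ≟ c l
  ... | yes refl = ≤-reflexive (sym (exchangeʷ-c l))
  ... | no e≢c   = subst (lookup (x'ʷ (wᶜ l)) e ≤_)
                         (sym (exchangeʷ-other l (λ e≡a' → e∉a (next l) (sym e≡a')) e≢c))
                         (x'ʷ≤xʷ-off-a (wᶜ l) e e∉a)

  C-exchangeʷ∨ : ∀ l z' → In𝓑ᵥ (inj₁ (wᶜ l)) z' → ExceedsOnlyOnU⁺ (wᶜ l) z' →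
                 lookup z' (a (next l)) ≤ lookup (x'ʷ (wᶜ l)) (a (next l)) →
                 C (inj₁ (wᶜ l)) (exchangeʷ l ∨ z') ≡ exchangeʷ l
  C-exchangeʷ∨ l z' z'∈𝓑 exceeds z'≤x'ʷ =
    C-∨-uninteresting (inj₁ (wᶜ l)) (exchangeʷ l) z' (exchangeʷ∈𝓑 l) exchangeʷ-acceptable z'∈𝓑 uninteresting
    where
    exchangeʷ-acceptable : Acceptable (inj₁ (wᶜ l)) (exchangeʷ l)
    exchangeʷ-acceptable = let ((_ , _ , _ , _ , acceptable) , _) = wpair l in acceptable
    uninteresting : ∀ d → lookup (exchangeʷ l) d < lookup z' d → ¬ Interesting (inj₁ (wᶜ l)) (exchangeʷ l) d
    uninteresting d u<z' = proj₂ (wpair l) d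
      (exceeds⇒U⁺ (wᶜ l) (exchangeʷ l) z' (x'ʷ≤exchangeʷ-off-a l) exceeds d u<z')
      (positive⇒∈E (inj₁ (wᶜ l)) z' d z'∈𝓑 (≤-<-trans z≤n u<z'))
      d≢a'
      where
      d≢a' : d ≢ a (next l)
      d≢a' refl = <⇒≱ u<z' (≤-trans z'≤x'ʷ (≤-reflexive (sym (exchangeʷ-next-a l))))

  x'ʷ≤C-at-next-a : ∀ l z' → In𝓑ᵥ (inj₁ (wᶜ l)) z' → x'ʷ (wᶜ l) ≤ᵛ z' → ExceedsOnlyOnU⁺ (wᶜ l) z' →
                    lookup z' (a (next l)) ≤ lookup (x'ʷ (wᶜ l)) (a (next l)) →
                    lookup (x'ʷ (wᶜ l)) (a (next l)) ≤ lookup (C (inj₁ (wᶜ l)) z') (a (next l))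
  x'ʷ≤C-at-next-a l z' z'∈𝓑 x'≤z' exceeds z'≤x' =
    A2-∨ʳ (inj₁ (wᶜ l)) (exchangeʷ l) z' (exchangeʷ∈𝓑 l) z'∈𝓑 (a (next l))
      (≤-reflexive (trans (sym (exchangeʷ-next-a l))
                          (cong (λ u → lookup u (a (next l))) (sym (C-exchangeʷ∨ l z' z'∈𝓑 exceeds z'≤x')))))
      (x'≤z' (a (next l)))

  x'ʷ≤C : ∀ w z' → In𝓑ᵥ (inj₁ w) z' → x'ʷ w ≤ᵛ z' → ExceedsOnlyOnU⁺ w z' →
          ∀ d → lookup z' d ≤ lookup (x'ʷ w) d → lookup (x'ʷ w) d ≤ lookup (C (inj₁ w) z') d
  x'ʷ≤C w z' z'∈𝓑 x'≤z' exceeds d z'≤x' with role d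
  ... | rotated-c j refl = x'ʷ≤C-off-a w z' z'∈𝓑 x'≤z' exceeds d (λ i → a≢c i j)
  ... | fixed d∉a _      = x'ʷ≤C-off-a w z' z'∈𝓑 x'≤z' exceeds d d∉a
  ... | rotated-a j refl with d ∈E? inj₁ w
  ...   | no d∉w = subst (_≤ _) (sym (lookup-restr-∉ x' (inj₁ w) d∉w)) z≤n
  ...   | yes d∈w with next-surjective j
  ...     | l , refl with trans (sym (wOf-next-a l)) (∈E⇒wOf≡ d∈w)
  ...       | refl = x'ʷ≤C-at-next-a l z' z'∈𝓑 x'≤z' exceeds z'≤x'

  x'ʷ-acceptable : ∀ w → Acceptable (inj₁ w) (x'ʷ w)
  x'ʷ-acceptable w = lookup≗⇒≡ λ e → ≤-antisym (C≤ (inj₁ w) (x'ʷ w) (x'ʷ∈𝓑 w) e)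
    (x'ʷ≤C w (x'ʷ w) (x'ʷ∈𝓑 w) (λ _ → ≤-refl) (λ d x'<x' → ⊥-elim (<-irrefl refl x'<x')) e ≤-refl)

  U⁺⇒¬interesting-x'ʷ : ∀ w e → U⁺ x e → ¬ Interesting (inj₁ w) (x'ʷ w) e
  U⁺⇒¬interesting-x'ʷ w e e∈U⁺ (_ , z' , z'∈𝓑 , agree , x'<z' , x'<Cz') =
    <⇒≱ (sum-mono-< (x'ʷ w) (C (inj₁ w) z') x'≤Cz' e x'<Cz') (begin
      ∣ C (inj₁ w) z' ∣          ≤⟨ A3-∨ʳ (inj₁ w) (xʷ w) z' (xʷ∈𝓑 w) z'∈𝓑 ⟩
      ∣ C (inj₁ w) (xʷ w ∨ z') ∣ ≡⟨ cong ∣_∣ (C-xʷ∨ w z' z'∈𝓑 exceeds) ⟩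
      ∣ xʷ w ∣                   ≡⟨ ∣x'ᵥ∣≡∣xᵥ∣ (inj₁ w) ⟨
      ∣ x'ʷ w ∣                  ∎)
    where
    open ≤-Reasoning
    exceeds : ExceedsOnlyOnU⁺ w z'
    exceeds d x'<z' = subst (U⁺ x) (sym (agree-off⇒exceeds-only-at (x'ʷ w) z' agree d x'<z')) e∈U⁺
    x'≤Cz' : ∀ d → lookup (x'ʷ w) d ≤ lookup (C (inj₁ w) z') d
    x'≤Cz' d with d ≟ e
    ... | yes refl = <⇒≤ x'<Cz'
    ... | no d≢e   =
      x'ʷ≤C w z' z'∈𝓑 (agree-off⇒≤ᵛ (x'ʷ w) z' agree x'<z') exceeds d (≤-reflexive (agree d d≢e))

  -- Firms

  xᶠ x'ᶠ : Fin nF → Vecᴱ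
  xᶠ  f = restr x  (inj₂ f)
  x'ᶠ f = restr x' (inj₂ f)

  xᶠ∈𝓑 : ∀ f → In𝓑ᵥ (inj₂ f) (xᶠ f)
  xᶠ∈𝓑 f = restr-∈𝓑ᵥ x (inj₂ f) x∈𝓑

  x'ᶠ∈𝓑 : ∀ f → In𝓑ᵥ (inj₂ f) (x'ᶠ f)
  x'ᶠ∈𝓑 f = restr-∈𝓑ᵥ x' (inj₂ f) x'∈𝓑

  x'ᶠ∨xᶠ∈𝓑 : ∀ f → In𝓑ᵥ (inj₂ f) (x'ᶠ f ∨ xᶠ f)
  x'ᶠ∨xᶠ∈𝓑 f = ∨-∈𝓑ᵥ (inj₂ f) (x'ᶠ f) (xᶠ f) (x'ᶠ∈𝓑 f) (xᶠ∈𝓑 f)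

  x'ᶠ≡xᶠ-untouched : ∀ f → (∀ i → fᵃ i ≢ f) → x'ᶠ f ≡ xᶠ f
  x'ᶠ≡xᶠ-untouched f untouched = lookup≗⇒≡ x'ᶠ≗xᶠ
    where
    x'ᶠ≗xᶠ : ∀ e → lookup (x'ᶠ f) e ≡ lookup (xᶠ f) e
    x'ᶠ≗xᶠ e with e ∈E? inj₂ f
    ... | no e∉f = trans (lookup-restr-∉ x' (inj₂ f) e∉f) (sym (lookup-restr-∉ x (inj₂ f) e∉f))
    ... | yes e∈f with role e
    ...   | rotated-a j refl = ⊥-elim (untouched j (∈E⇒fOf≡ e∈f))
    ...   | rotated-c j refl = ⊥-elim (untouched j (trans (sym (fOf-c j)) (∈E⇒fOf≡ e∈f)))
    ...   | fixed e∉a e∉c    = trans (lookup-restr-∈ x' (inj₂ f) e∈f)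
                                (trans (x'-fixed e∉a e∉c) (sym (lookup-restr-∈ x (inj₂ f) e∈f)))

  xᶠ+a : Fin (suc n) → Vecᴱ
  xᶠ+a j = plus1 (xᶠ (fᵃ j)) (a j)

  xᶠ+a-c : ∀ j → lookup (xᶠ+a j) (c j) ≡ lookup x (c j)
  xᶠ+a-c j = trans (lookup-plus1-≢ (xᶠ (fᵃ j)) (λ c≡a → a≢c j j (sym c≡a)))
                   (lookup-restr-∈ x (inj₂ (fᵃ j)) (c∈Eᶠ j))

  legal-F-pair : ∀ j → plus1 (C (inj₂ (fᵃ j)) (xᶠ+a j)) (c j) ≡ xᶠ+a j
  legal-F-pair j = let (_ , _ , _ , _ , legal) = fpair j in legal

  C-xᶠ+a-c : ∀ j → lookup (C (inj₂ (fᵃ j)) (xᶠ+a j)) (c j) ≡ lookup x' (c j)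
  C-xᶠ+a-c j = suc-injective (begin
    suc (lookup (C (inj₂ (fᵃ j)) (xᶠ+a j)) (c j))           ≡⟨ lookup-plus1-≡ (C (inj₂ (fᵃ j)) (xᶠ+a j)) (c j) ⟨
    lookup (plus1 (C (inj₂ (fᵃ j)) (xᶠ+a j)) (c j)) (c j)   ≡⟨ cong (λ u → lookup u (c j)) (legal-F-pair j) ⟩
    lookup (xᶠ+a j) (c j)                                   ≡⟨ xᶠ+a-c j ⟩
    lookup x (c j)                                          ≡⟨ x'-c+1 j ⟨
    suc (lookup x' (c j))                                   ∎)
    where open ≡-Reasoning

  ∣C-xᶠ+a∣ : ∀ j → ∣ C (inj₂ (fᵃ j)) (xᶠ+a j) ∣ ≡ ∣ xᶠ (fᵃ j) ∣
  ∣C-xᶠ+a∣ j = suc-injective (begin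
    suc ∣ C (inj₂ (fᵃ j)) (xᶠ+a j) ∣             ≡⟨ ∣plus1∣ (C (inj₂ (fᵃ j)) (xᶠ+a j)) (c j) ⟨
    ∣ plus1 (C (inj₂ (fᵃ j)) (xᶠ+a j)) (c j) ∣   ≡⟨ cong ∣_∣ (legal-F-pair j) ⟩
    ∣ xᶠ+a j ∣                                   ≡⟨ ∣plus1∣ (xᶠ (fᵃ j)) (a j) ⟩
    suc ∣ xᶠ (fᵃ j) ∣                            ∎)
    where open ≡-Reasoning

  xᶠ+a≤x'ᶠ∨xᶠ : ∀ {f} j → fᵃ j ≡ f → xᶠ+a j ≤ᵛ (x'ᶠ f ∨ xᶠ f)
  xᶠ+a≤x'ᶠ∨xᶠ {f} j refl e with e ≟ a j
  ... | yes refl = ≤-trans (≤-reflexive xᶠ+a≡x'ᶠ-at-a) (≤ᵛ-∨ˡ (x'ᶠ f) (xᶠ f) e)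
    where
    xᶠ+a≡x'ᶠ-at-a : lookup (xᶠ+a j) (a j) ≡ lookup (x'ᶠ f) (a j)
    xᶠ+a≡x'ᶠ-at-a = trans (lookup-plus1-≡ (xᶠ f) (a j))
      (trans (cong suc (lookup-restr-∈ x (inj₂ f) (a∈Eᶠ j)))
             (trans (sym (x'-a j)) (sym (lookup-restr-∈ x' (inj₂ f) (a∈Eᶠ j)))))
  ... | no e≢a = subst (_≤ lookup (x'ᶠ f ∨ xᶠ f) e) (sym (lookup-plus1-≢ (xᶠ f) e≢a))
                       (≤ᵛ-∨ʳ (x'ᶠ f) (xᶠ f) e)

  xᶠ+a∈𝓑 : ∀ j → In𝓑ᵥ (inj₂ (fᵃ j)) (xᶠ+a j)
  xᶠ+a∈𝓑 j =
    ≤ᵛ-∈𝓑ᵥ (inj₂ (fᵃ j)) (xᶠ+a j) (x'ᶠ (fᵃ j) ∨ xᶠ (fᵃ j)) (xᶠ+a≤x'ᶠ∨xᶠ j refl) (x'ᶠ∨xᶠ∈𝓑 (fᵃ j))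

  C-c≤x'ᶠ : ∀ {f} j → fᵃ j ≡ f → ∀ Z → In𝓑ᵥ (inj₂ f) Z → xᶠ+a j ≤ᵛ Z →
            lookup (C (inj₂ f) Z) (c j) ≤ lookup (x'ᶠ f) (c j)
  C-c≤x'ᶠ {f} j refl Z Z∈𝓑 xᶠ+a≤Z =
    A2-upper (inj₂ f) Z (xᶠ+a j) Z∈𝓑 (xᶠ+a∈𝓑 j) xᶠ+a≤Z (c j)
      (≤-reflexive (trans (C-xᶠ+a-c j) (sym x'ᶠ≡x'-at-c)))
      (≤-reflexive (trans (cong suc x'ᶠ≡x'-at-c) (trans (x'-c+1 j) (sym (xᶠ+a-c j)))))
    where
    x'ᶠ≡x'-at-c : lookup (x'ᶠ f) (c j) ≡ lookup x' (c j)
    x'ᶠ≡x'-at-c = lookup-restr-∈ x' (inj₂ f) (c∈Eᶠ j)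

  C-x'ᶠ∨xᶠ≤x'ᶠ-off-c : ∀ f e → (∀ j → c j ≢ e) →
                       lookup (C (inj₂ f) (x'ᶠ f ∨ xᶠ f)) e ≤ lookup (x'ᶠ f) e
  C-x'ᶠ∨xᶠ≤x'ᶠ-off-c f e e∉c = ≤-trans (C≤ (inj₂ f) (x'ᶠ f ∨ xᶠ f) (x'ᶠ∨xᶠ∈𝓑 f) e)
    (∨-least (x'ᶠ f) (xᶠ f) e ≤-refl (lookup-restr-mono x x' (inj₂ f) e (x≤x'-off-c e e∉c)))

  C-x'ᶠ∨xᶠ≤x'ᶠ : ∀ f e → lookup (C (inj₂ f) (x'ᶠ f ∨ xᶠ f)) e ≤ lookup (x'ᶠ f) e
  C-x'ᶠ∨xᶠ≤x'ᶠ f e with role e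
  ... | rotated-a j refl = C-x'ᶠ∨xᶠ≤x'ᶠ-off-c f e (λ i c≡a → a≢c j i (sym c≡a))
  ... | fixed _ e∉c      = C-x'ᶠ∨xᶠ≤x'ᶠ-off-c f e e∉c
  ... | rotated-c j refl with e ∈E? inj₂ f
  ...   | yes e∈f = C-c≤x'ᶠ j fᵃ≡f (x'ᶠ f ∨ xᶠ f) (x'ᶠ∨xᶠ∈𝓑 f) (xᶠ+a≤x'ᶠ∨xᶠ j fᵃ≡f)
    where fᵃ≡f = trans (sym (fOf-c j)) (∈E⇒fOf≡ e∈f)
  ...   | no e∉f  = subst (_≤ _) (sym (proj₂ C∈𝓑 e e∉f)) z≤n
    where
    C∈𝓑 : In𝓑ᵥ (inj₂ f) (C (inj₂ f) (x'ᶠ f ∨ xᶠ f))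
    C∈𝓑 = ≤ᵛ-∈𝓑ᵥ (inj₂ f) (C (inj₂ f) (x'ᶠ f ∨ xᶠ f)) (x'ᶠ f ∨ xᶠ f)
             (C≤ (inj₂ f) (x'ᶠ f ∨ xᶠ f) (x'ᶠ∨xᶠ∈𝓑 f)) (x'ᶠ∨xᶠ∈𝓑 f)

  C-x'ᶠ∨xᶠ : ∀ {f} i → fᵃ i ≡ f → C (inj₂ f) (x'ᶠ f ∨ xᶠ f) ≡ x'ᶠ f
  C-x'ᶠ∨xᶠ {f} i refl =
    pointwise-≤∧sum-≥⇒≡ (C (inj₂ f) (x'ᶠ f ∨ xᶠ f)) (x'ᶠ f) (C-x'ᶠ∨xᶠ≤x'ᶠ f) (begin
      ∣ x'ᶠ f ∣                        ≡⟨ ∣x'ᵥ∣≡∣xᵥ∣ (inj₂ f) ⟩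
      ∣ xᶠ f ∣                         ≡⟨ ∣C-xᶠ+a∣ i ⟨
      ∣ C (inj₂ f) (xᶠ+a i) ∣          ≤⟨ A3 (inj₂ f) (x'ᶠ f ∨ xᶠ f) (xᶠ+a i) (x'ᶠ∨xᶠ∈𝓑 f) (xᶠ+a∈𝓑 i)
                                             (xᶠ+a≤x'ᶠ∨xᶠ i refl) ⟩
      ∣ C (inj₂ f) (x'ᶠ f ∨ xᶠ f) ∣    ∎)
    where open ≤-Reasoning

  x'ᶠ-acceptable-touched : ∀ {f} i → fᵃ i ≡ f → Acceptable (inj₂ f) (x'ᶠ f)
  x'ᶠ-acceptable-touched {f} i fᵃ≡f = trans
    (A1 (inj₂ f) (x'ᶠ f ∨ xᶠ f) (x'ᶠ f) (x'ᶠ∨xᶠ∈𝓑 f) (x'ᶠ∈𝓑 f) (≤ᵛ-∨ˡ (x'ᶠ f) (xᶠ f))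
        (λ e → ≤-reflexive (cong (λ u → lookup u e) (C-x'ᶠ∨xᶠ i fᵃ≡f))))
    (C-x'ᶠ∨xᶠ i fᵃ≡f)

  xᶠ≺x'ᶠ : ∀ {f} i → fᵃ i ≡ f → xᶠ f ≺[ inj₂ f ] x'ᶠ f
  xᶠ≺x'ᶠ {f} i fᵃ≡f =
    x-acceptable (inj₂ f) , x'ᶠ-acceptable-touched i fᵃ≡f , xᶠ≢x'ᶠ , C-x'ᶠ∨xᶠ i fᵃ≡f
    where
    a∈f : a i ∈E inj₂ f
    a∈f = dec-true (fᵃ i ≟ f) fᵃ≡f
    xᶠ≢x'ᶠ : xᶠ f ≢ x'ᶠ f
    xᶠ≢x'ᶠ xᶠ≡x'ᶠ = 1+n≢n (sym (begin
      lookup x (a i)          ≡⟨ lookup-restr-∈ x (inj₂ f) a∈f ⟨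
      lookup (xᶠ f) (a i)     ≡⟨ cong (λ u → lookup u (a i)) xᶠ≡x'ᶠ ⟩
      lookup (x'ᶠ f) (a i)    ≡⟨ lookup-restr-∈ x' (inj₂ f) a∈f ⟩
      lookup x' (a i)         ≡⟨ x'-a i ⟩
      suc (lookup x (a i))    ∎))
      where open ≡-Reasoning

  C-fixed≤x'ᶠ : ∀ e → (∀ j → a j ≢ e) → (∀ j → c j ≢ e) → ¬ U⁺ x e →
                ∀ Z → In𝓑ᵥ (inj₂ (fOf e)) Z → xᶠ (fOf e) ≤ᵛ Z →
                lookup (C (inj₂ (fOf e)) Z) e ≤ lookup (x'ᶠ (fOf e)) e
  C-fixed≤x'ᶠ e e∉a e∉c e∉U⁺ Z Z∈𝓑 xᶠ≤Z = subst (lookup (C v Z) e ≤_) xᶠ≡x'ᶠ-at-e C≤xᶠ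
    where
    v = inj₂ (fOf e)
    z = xᶠ (fOf e)
    e∈v : e ∈E v
    e∈v = dec-true (fOf e ≟ fOf e) refl
    xᶠ≡x'ᶠ-at-e : lookup z e ≡ lookup (x'ᶠ (fOf e)) e
    xᶠ≡x'ᶠ-at-e =
      trans (lookup-restr-∈ x v e∈v) (trans (sym (x'-fixed e∉a e∉c)) (sym (lookup-restr-∈ x' v e∈v)))
    C≤xᶠ : lookup (C v Z) e ≤ lookup z e
    C≤xᶠ with lookup z e <? lookup Z e
    ... | no z≮Z  = ≤-trans (C≤ v Z Z∈𝓑 e) (≮⇒≥ z≮Z)
    ... | yes z<Z = A2-upper v Z zᵉ Z∈𝓑 zᵉ∈𝓑 zᵉ≤Z e (≤-reflexive (cong (λ u → lookup u e) C-zᵉ))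
                      (subst (lookup z e <_) (sym (lookup∘update e z _)) z<Z)
      where
      zᵉ : Vecᴱ
      zᵉ = z [ e ]≔ lookup Z e
      zᵉ≤Z : zᵉ ≤ᵛ Z
      zᵉ≤Z = update-≤ᵛ z Z e xᶠ≤Z ≤-refl
      zᵉ∈𝓑 : In𝓑ᵥ v zᵉ
      zᵉ∈𝓑 = ≤ᵛ-∈𝓑ᵥ v zᵉ Z zᵉ≤Z Z∈𝓑
      exceeds-only-at-e : ∀ d → lookup z d < lookup zᵉ d → d ≡ e
      exceeds-only-at-e = agree-off⇒exceeds-only-at z zᵉ (λ d d≢e → lookup∘update′ d≢e z _)
      C-zᵉ : C v zᵉ ≡ z
      C-zᵉ = C-of-uninteresting-extension v z zᵉ (xᶠ∈𝓑 (fOf e)) (x-acceptable v) zᵉ∈𝓑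
        (≤ᵛ-update z e (<⇒≤ z<Z))
        (λ d z<zᵉ → subst (λ d → ¬ Interesting v z d) (sym (exceeds-only-at-e d z<zᵉ)) e∉U⁺)

  C-¬U⁺≤x'ᶠ : ∀ e → ¬ U⁺ x e → ∀ Z → In𝓑ᵥ (inj₂ (fOf e)) Z → (x'ᶠ (fOf e) ∨ xᶠ (fOf e)) ≤ᵛ Z →
              lookup (C (inj₂ (fOf e)) Z) e ≤ lookup (x'ᶠ (fOf e)) e
  C-¬U⁺≤x'ᶠ e e∉U⁺ Z Z∈𝓑 Y≤Z with role e
  ... | rotated-a j refl = ⊥-elim (e∉U⁺ (a∈U⁺ j))
  ... | rotated-c j refl = C-c≤x'ᶠ j (sym (fOf-c j)) Z Z∈𝓑
                             (λ d → ≤-trans (xᶠ+a≤x'ᶠ∨xᶠ j (sym (fOf-c j)) d) (Y≤Z d))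
  ... | fixed e∉a e∉c    = C-fixed≤x'ᶠ e e∉a e∉c e∉U⁺ Z Z∈𝓑
                             (λ d → ≤-trans (≤ᵛ-∨ʳ (x'ᶠ (fOf e)) (xᶠ (fOf e)) d) (Y≤Z d))

  C-x'ᶠ∨xᶠ∨z' : ∀ i e → fᵃ i ≡ fOf e → ¬ U⁺ x e → ∀ z' → In𝓑ᵥ (inj₂ (fOf e)) z' →
                (∀ d → d ≢ e → lookup z' d ≡ lookup (x'ᶠ (fOf e)) d) →
                C (inj₂ (fOf e)) ((x'ᶠ (fOf e) ∨ xᶠ (fOf e)) ∨ z') ≡ x'ᶠ (fOf e)
  C-x'ᶠ∨xᶠ∨z' i e fᵃ≡f e∉U⁺ z' z'∈𝓑 agree =
    pointwise-≤∧sum-≥⇒≡ (C v Z) (x'ᶠ (fOf e)) CZ≤x'ᶠ (begin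
      ∣ x'ᶠ (fOf e) ∣ ≡⟨ cong ∣_∣ (C-x'ᶠ∨xᶠ i fᵃ≡f) ⟨
      ∣ C v Y ∣       ≤⟨ A3 v Z Y Z∈𝓑 (x'ᶠ∨xᶠ∈𝓑 (fOf e)) Y≤Z ⟩
      ∣ C v Z ∣       ∎)
    where
    open ≤-Reasoning
    v = inj₂ (fOf e)
    Y = x'ᶠ (fOf e) ∨ xᶠ (fOf e)
    Z = Y ∨ z'
    Z∈𝓑 : In𝓑ᵥ v Z
    Z∈𝓑 = ∨-∈𝓑ᵥ v Y z' (x'ᶠ∨xᶠ∈𝓑 (fOf e)) z'∈𝓑
    Y≤Z : Y ≤ᵛ Z
    Y≤Z = ≤ᵛ-∨ˡ Y z'
    CZ≤x'ᶠ : ∀ d → lookup (C v Z) d ≤ lookup (x'ᶠ (fOf e)) d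
    CZ≤x'ᶠ d with d ≟ e
    ... | yes refl = C-¬U⁺≤x'ᶠ e e∉U⁺ Z Z∈𝓑 Y≤Z
    ... | no d≢e   = subst (lookup (C v Z) d ≤_) (cong (λ u → lookup u d) (C-x'ᶠ∨xᶠ i fᵃ≡f))
                       (A2-lower v Z Y Z∈𝓑 (x'ᶠ∨xᶠ∈𝓑 (fOf e)) Y≤Z d ≤-refl CZ≤Y)
      where
      z'≤Y : lookup z' d ≤ lookup Y d
      z'≤Y = subst (_≤ lookup Y d) (sym (agree d d≢e)) (≤ᵛ-∨ˡ (x'ᶠ (fOf e)) (xᶠ (fOf e)) d)
      CZ≤Y : lookup (C v Z) d ≤ lookup Y d
      CZ≤Y = ≤-trans (C≤ v Z Z∈𝓑 d) (∨-least Y z' d ≤-refl z'≤Y)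

  ¬U⁺⇒¬interesting-x'ᶠ-touched : ∀ i e → fᵃ i ≡ fOf e → ¬ U⁺ x e →
                                 ¬ Interesting (inj₂ (fOf e)) (x'ᶠ (fOf e)) e
  ¬U⁺⇒¬interesting-x'ᶠ-touched i e fᵃ≡f e∉U⁺ (_ , z' , z'∈𝓑 , agree , x'<z' , x'<Cz') =
    <⇒≱ (sum-mono-< (x'ᶠ (fOf e)) (C v z') x'≤Cz' e x'<Cz') (begin
      ∣ C v z' ∣       ≤⟨ A3-∨ʳ v Y z' (x'ᶠ∨xᶠ∈𝓑 (fOf e)) z'∈𝓑 ⟩
      ∣ C v (Y ∨ z') ∣ ≡⟨ cong ∣_∣ CY∨z'≡x'ᶠ ⟩
      ∣ x'ᶠ (fOf e) ∣  ∎)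
    where
    open ≤-Reasoning
    v = inj₂ (fOf e)
    Y = x'ᶠ (fOf e) ∨ xᶠ (fOf e)
    CY∨z'≡x'ᶠ : C v (Y ∨ z') ≡ x'ᶠ (fOf e)
    CY∨z'≡x'ᶠ = C-x'ᶠ∨xᶠ∨z' i e fᵃ≡f e∉U⁺ z' z'∈𝓑 agree
    x'≤Cz' : ∀ d → lookup (x'ᶠ (fOf e)) d ≤ lookup (C v z') d
    x'≤Cz' d = A2-∨ʳ v Y z' (x'ᶠ∨xᶠ∈𝓑 (fOf e)) z'∈𝓑 d
                 (≤-reflexive (cong (λ u → lookup u d) (sym CY∨z'≡x'ᶠ)))
                 (agree-off⇒≤ᵛ (x'ᶠ (fOf e)) z' agree x'<z' d)

  touched? : ∀ f → Dec (∃ λ i → fᵃ i ≡ f)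
  touched? f = any? (λ i → fᵃ i ≟ f)

  x'ᶠ-acceptable : ∀ f → Acceptable (inj₂ f) (x'ᶠ f)
  x'ᶠ-acceptable f with touched? f
  ... | yes (i , fᵃ≡f) = x'ᶠ-acceptable-touched i fᵃ≡f
  ... | no untouched   = subst (Acceptable (inj₂ f))
                           (sym (x'ᶠ≡xᶠ-untouched f λ i fᵃ≡f → untouched (i , fᵃ≡f)))
                           (x-acceptable (inj₂ f))

  ¬U⁺⇒¬interesting-x'ᶠ : ∀ e → ¬ U⁺ x e → ¬ Interesting (inj₂ (fOf e)) (x'ᶠ (fOf e)) e
  ¬U⁺⇒¬interesting-x'ᶠ e e∉U⁺ with touched? (fOf e)
  ... | yes (i , fᵃ≡f) = ¬U⁺⇒¬interesting-x'ᶠ-touched i e fᵃ≡f e∉U⁺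
  ... | no untouched   = e∉U⁺ ∘ subst (λ u → Interesting (inj₂ (fOf e)) u e)
                           (x'ᶠ≡xᶠ-untouched (fOf e) λ i fᵃ≡f → untouched (i , fᵃ≡f))

  x'-stable : Stable x'
  x'-stable = (x'∈𝓑 , x'-acceptable) , x'-unblocked
    where
    x'-acceptable : ∀ v → Acceptable v (restr x' v)
    x'-acceptable (inj₁ w) = x'ʷ-acceptable w
    x'-acceptable (inj₂ f) = x'ᶠ-acceptable f
    x'-unblocked : ∀ e → ¬ Blocks x' e
    x'-unblocked e (interestingʷ , interestingᶠ) =
      ¬U⁺⇒¬interesting-x'ᶠ e (λ e∈U⁺ → U⁺⇒¬interesting-x'ʷ (wOf e) e e∈U⁺ interestingʷ) interestingᶠ

  x≺Fx' : x ≺F x'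
  x≺Fx' = x≢x' , xᶠ⪯x'ᶠ
    where
    x≢x' : x ≢ x'
    x≢x' x≡x' = 1+n≢n (sym (trans (cong (λ u → lookup u (a zero)) x≡x') (x'-a zero)))
    xᶠ⪯x'ᶠ : ∀ f → xᶠ f ⪯[ inj₂ f ] x'ᶠ f
    xᶠ⪯x'ᶠ f with touched? f
    ... | yes (i , fᵃ≡f) = inj₂ (xᶠ≺x'ᶠ i fᵃ≡f)
    ... | no untouched   = inj₁ (sym (x'ᶠ≡xᶠ-untouched f λ i fᵃ≡f → untouched (i , fᵃ≡f)))

proposition3p4 : (G : Graph) (M : ChoiceModel G) →
    let open Model G M in
    (xmax : Vecᴱ) → IsMax xmax →
    (x : Vecᴱ) → Stable x → x ≢ xmax →
    (R : Rotation x) →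
    Stable (applyRot x R) × (x ≺F applyRot x R)
proposition3p4 G M _ _ x x-stable _ R = x'-stable , x≺Fx'
  where open RotationStep G M x-stable R
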